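{- Let $G$ be a graph such that $V(G)$ is partitioned into maximal modules $S_1,\dots,S_m$, and let $H=G(Q_1,\dots,Q_m)$ be the clique skeleton of $G$. Let $\ell\ge\chi(G)+1$. If every proper induced subgraph of $G$ is recolorable, then $R_\ell(G)$ is connected if and only if $R_\ell(H)$ is connected.
   Context: Graphs are finite and simple. A $k$-coloring of $G$ is a map $V(G)\to\{1,\dots,k\}$ giving adjacent vertices different colors; $\chi(G)$ is the chromatic number. $R_\ell(G)$ is the graph whose vertices are the $\ell$-colorings of $G$, two adjacent if they differ on exactly one vertex. $G$ is recolorable if $R_\ell(G)$ is connected for every $\ell\ge\chi(G)+1$. A module is a non-empty $S\subseteq V(G)$ such that every vertex outside $S$ is adjacent to all or none of $S$; a maximal module is a module $S\subsetneq V(G)$ not contained in any larger module properly contained in $V(G)$. Given the partition of $V(G)$ into maximal modules $S_1,\dots,S_m$ (so for $p\ne q$, $S_p$ is either complete or anticomplete to $S_q$), the clique skeleton $G(Q_1,\dots,Q_m)$ is the graph obtained by replacing each $S_p$ by a clique $Q_p$ of size $\chi(G[S_p])$, where every vertex of $Q_p$ is adjacent to every vertex of $Q_q$ ($p\neq q$) exactly when $S_p$ is complete to $S_q$ in $G$. -}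

module Defs where

open import Level using (0ℓ)
open import Data.Nat using (ℕ; suc; _≤_)
open import Data.Fin using (Fin; _≟_; toℕ)
open import Data.Bool using (Bool; true; false)
open import Data.Product using (Σ; ∃; _×_; _,_; proj₁)
open import Data.Sum using (_⊎_)
open import Relation.Nullary using (¬_; does)
open import Relation.Binary.PropositionalEquality using (_≡_; _≢_)
open import Relation.Binary.Construct.Closure.ReflexiveTransitive using (Star)

-- Simplicity
-- (symmetry, irreflexivity) is imposed as a hypothesis where needed;
-- all constructions below (induced subgraphs, clique skeleton)
-- preserve it.
record Graph : Set₁ where
  constructor mkGraph
  field
    V : Set
    E : V → V → Set
open Graph public

FinGraph : (n : ℕ) → (Fin n → Fin n → Bool) → Graph
FinGraph n adj = mkGraph (Fin n) (λ u v → adj u v ≡ true)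

IsColoring : (G : Graph) (k : ℕ) → (V G → Fin k) → Set
IsColoring G k α = ∀ u v → E G u v → α u ≢ α v

Coloring : Graph → ℕ → Set
Coloring G k = Σ (V G → Fin k) (IsColoring G k)

Colorable : Graph → ℕ → Set
Colorable G k = Coloring G k

IsChromaticNumber : Graph → ℕ → Set
IsChromaticNumber G k = Colorable G k × (∀ j → Colorable G j → k ≤ j)

RAdj : (G : Graph) (ℓ : ℕ) → Coloring G ℓ → Coloring G ℓ → Set
RAdj G ℓ (α , _) (β , _) =
  ∃ λ v → α v ≢ β v × (∀ u → u ≢ v → α u ≡ β u)

-- Colorings are functions; two colorings are the same vertex of R_ℓ(G)
-- when they agree pointwise (no function extensionality in Agda).
SameColoring : (G : Graph) (ℓ : ℕ) → Coloring G ℓ → Coloring G ℓ → Set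
SameColoring G ℓ (α , _) (β , _) = ∀ v → α v ≡ β v

RConnected : Graph → ℕ → Set
RConnected G ℓ = ∀ (α β : Coloring G ℓ) →
  Star (λ x y → RAdj G ℓ x y ⊎ SameColoring G ℓ x y) α β

Recolorable : Graph → Set
Recolorable G = ∀ k → IsChromaticNumber G k → ∀ ℓ → suc k ≤ ℓ → RConnected G ℓ

Induced : (G : Graph) → (V G → Bool) → Graph
Induced G S = mkGraph (Σ (V G) (λ v → S v ≡ true))
                      (λ u v → E G (proj₁ u) (proj₁ v))

IsModule : (G : Graph) → (V G → Bool) → Set
IsModule G S =
  (∃ λ v → S v ≡ true) ×
  (∀ v → S v ≡ false →
     (∀ u → S u ≡ true → E G v u) ⊎ (∀ u → S u ≡ true → ¬ E G v u))

IsMaximalModule : (G : Graph) → (V G → Bool) → Set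
IsMaximalModule G S =
  IsModule G S × (∃ λ v → S v ≡ false) ×
  (∀ T → IsModule G T → (∃ λ v → T v ≡ false) →
     (∀ v → S v ≡ true → T v ≡ true) → (∀ v → T v ≡ true → S v ≡ true))

Part : {n m : ℕ} → (Fin n → Fin m) → Fin m → Fin n → Bool
Part part p v = does (part v ≟ p)

IsMaximalModulePartition : (n : ℕ) (adj : Fin n → Fin n → Bool) (m : ℕ) →
                           (Fin n → Fin m) → Set
IsMaximalModulePartition n adj m part =
  (∀ p → ∃ λ v → part v ≡ p) ×
  (∀ p → IsMaximalModule (FinGraph n adj) (Part part p))

Complete : (n : ℕ) (adj : Fin n → Fin n → Bool) {m : ℕ} →
           (Fin n → Fin m) → Fin m → Fin m → Set
Complete n adj part p q =
  ∀ u v → Part part p u ≡ true → Part part q v ≡ true → adj u v ≡ true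

-- Clique skeleton G(Q_1,…,Q_m), where c p = χ(G[S_p]) is the size of Q_p.
CliqueSkeleton : (n : ℕ) (adj : Fin n → Fin n → Bool) (m : ℕ) →
                 (Fin n → Fin m) → (Fin m → ℕ) → Graph
CliqueSkeleton n adj m part c =
  mkGraph (Σ (Fin m) (λ p → Fin (c p)))
          (λ { (p , i) (q , j) →
               (p ≡ q × toℕ i ≢ toℕ j) ⊎ (p ≢ q × Complete n adj part p q) })

{-# OPTIONS --safe #-}
-- Both directions compare ℓ-colorings of G with pullbacks γ ∘ π of ℓ-colorings γ of H
-- along maps π : G → H sending S_p to Q_p through a χ(G[S_p])-coloring of G[S_p].
--
-- (⇐) Module by module, an ℓ-coloring of G is recolored until S_p uses exactly χ(G[S_p])
-- colors: S_p only uses colors absent from its neighbourhood, and if there are more of those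
-- than χ(G[S_p]), recolorability of the proper induced subgraph G[S_p] moves it to an optimal
-- coloring. The result is a pullback. A walk in R_ℓ(H) pulls back to a walk in R_ℓ(G), one
-- vertex of the recolored fibre at a time, and two pullbacks of the same coloring of H that
-- misses a color are joined by recoloring each G[S_p] with χ(G[S_p]) + 1 colors.
--
-- (⇒) Along a walk in R_ℓ(G) starting at a pullback of γ, maintain a coloring δ of H,
-- reachable from γ, all of whose colors on Q_p occur on S_p. When a step removes the last
-- occurrence of such a color, it is replaced by a color occurring on S_p but not on Q_p, which
-- exists because S_p always carries at least χ(G[S_p]) colors. In the end δ permutes, clique by
-- clique, the colors of a reference coloring missing one color, and K_c is recolorable with
-- c + 1 colors.
--
-- The reference coloring of H comes from a χ(G)-coloring of G, which leaves a color to spare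
-- because ℓ > χ(G).
module Submission where

open import Defs
open import Axiom.UniquenessOfIdentityProofs using (module Decidable⇒UIP)
open import Data.Bool using (Bool; true; false) renaming (_≟_ to _≟ᵇ_)
open import Data.Fin using (Fin; zero; suc; toℕ; fromℕ<; inject≤; punchIn; punchOut) renaming (_≟_ to _≟ᶠ_)
open import Data.Fin.Properties
  using (toℕ-injective; toℕ<n; toℕ-fromℕ<; suc-injective; any?; all?; ¬∀⟶∃¬;
         injective⇒≤; punchIn-injective; punchInᵢ≢i; punchOut-injective; punchIn-punchOut;
         inject≤-injective; toℕ-inject≤)
open import Data.Nat using (ℕ; zero; suc; _≤_; _<_; _<?_)
import Data.Nat.Properties as ℕ
open import Data.Product using (Σ; ∃; _×_; _,_; proj₁; proj₂)
open import Data.Product.Properties using (≡-dec; ,-injectiveʳ-UIP)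
open import Data.Sum using (_⊎_; inj₁; inj₂; [_,_]′)
open import Data.Vec.Functional using (_∷_)
open import Function using (_∘_; id; flip)
open import Relation.Binary.Construct.Closure.ReflexiveTransitive
  using (Star; ε; _◅_; _◅◅_; gmap; kleisliStar; reverse)
open import Relation.Binary.Definitions using (Symmetric; DecidableEquality)
open import Relation.Binary.PropositionalEquality using (_≡_; _≢_; refl; sym; trans; cong; subst)
open import Relation.Nullary using (¬_; Dec; yes; no; does; _×-dec_; _→-dec_; ¬?; contradiction)
open import Relation.Nullary.Decidable using (dec-true; dec-false)

-- Enumerating a decidable set of colors

count : ∀ {k} → (Fin k → Bool) → ℕ
count {zero}  P = 0
count {suc k} P with P zero
... | true  = suc (count (P ∘ suc))
... | false = count (P ∘ suc)

enum : ∀ {k} (P : Fin k → Bool) → Fin (count P) → Fin k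
enum {suc k} P i with P zero
enum {suc k} P zero    | true = zero
enum {suc k} P (suc i) | true = suc (enum (P ∘ suc) i)
... | false = suc (enum (P ∘ suc) i)

enum-sat : ∀ {k} (P : Fin k → Bool) i → P (enum P i) ≡ true
enum-sat {suc k} P i with P zero in eq
enum-sat {suc k} P zero    | true = eq
enum-sat {suc k} P (suc i) | true = enum-sat (P ∘ suc) i
... | false = enum-sat (P ∘ suc) i

enum-injective : ∀ {k} (P : Fin k → Bool) {i j} → enum P i ≡ enum P j → i ≡ j
enum-injective {suc k} P {i} {j} e with P zero
enum-injective {suc k} P {zero}  {zero}  e | true = refl
enum-injective {suc k} P {suc i} {suc j} e | true = cong suc (enum-injective (P ∘ suc) (suc-injective e))
... | false = enum-injective (P ∘ suc) (suc-injective e)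

index : ∀ {k} (P : Fin k → Bool) x → P x ≡ true → Fin (count P)
index {suc k} P zero px with P zero
... | true  = zero
... | false = contradiction px λ ()
index {suc k} P (suc x) px with P zero
... | true  = suc (index (P ∘ suc) x px)
... | false = index (P ∘ suc) x px

enum-index : ∀ {k} (P : Fin k → Bool) x (px : P x ≡ true) → enum P (index P x px) ≡ x
enum-index {suc k} P zero px with P zero
... | true  = refl
... | false = contradiction px λ ()
enum-index {suc k} P (suc x) px with P zero
... | true  = cong suc (enum-index (P ∘ suc) x px)
... | false = cong suc (enum-index (P ∘ suc) x px)

missed-value : ∀ {k ℓ} (d : Fin k → Fin ℓ) → k < ℓ → ∃ λ x → ∀ i → d i ≢ x
missed-value d k<ℓ with all? (λ x → any? (λ i → d i ≟ᶠ x))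
... | yes hit = contradiction (injective⇒≤ preimage-injective) (ℕ.<⇒≱ k<ℓ)
  where
  preimage-injective : ∀ {x y} → proj₁ (hit x) ≡ proj₁ (hit y) → x ≡ y
  preimage-injective {x} {y} e = trans (sym (proj₂ (hit x))) (trans (cong d e) (proj₂ (hit y)))
... | no ¬hit with ¬∀⟶∃¬ _ _ (λ x → any? (λ i → d i ≟ᶠ x)) ¬hit
... | x , unhit = x , λ i e → unhit (i , e)

-- If d misses U at i₀, at most k - 1 < count U elements of U are hit.
missed-value-in : ∀ {k ℓ} (d : Fin k → Fin ℓ) (U : Fin ℓ → Bool) → k ≤ count U →
                  ∀ i₀ → U (d i₀) ≡ false → ∃ λ x → U x ≡ true × (∀ i → d i ≢ x)
missed-value-in {suc k} d U k≤count i₀ d[i₀]∉U with all? (λ y → any? (λ i → d i ≟ᶠ enum U y))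
... | no ¬hit with ¬∀⟶∃¬ _ _ (λ y → any? (λ i → d i ≟ᶠ enum U y)) ¬hit
...   | y , unhit = enum U y , enum-sat U y , λ i e → unhit (i , e)
missed-value-in {suc k} d U k≤count i₀ d[i₀]∉U | yes hit =
  contradiction (injective⇒≤ squeezed-injective) (ℕ.<⇒≱ k≤count)
  where
  preimage : Fin (count U) → Fin (suc k)
  preimage y = proj₁ (hit y)
  avoids-i₀ : ∀ y → i₀ ≢ preimage y
  avoids-i₀ y i₀≡ = contradiction
    (trans (sym d[i₀]∉U) (trans (cong (U ∘ d) i₀≡) (trans (cong U (proj₂ (hit y))) (enum-sat U y))))
    λ ()
  squeezed-injective : ∀ {x y} → punchOut (avoids-i₀ x) ≡ punchOut (avoids-i₀ y) → x ≡ y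
  squeezed-injective {x} {y} e = enum-injective U
    (trans (sym (proj₂ (hit x)))
      (trans (cong d (punchOut-injective (avoids-i₀ x) (avoids-i₀ y) e)) (proj₂ (hit y))))

-- Chromatic numbers

least : ∀ {P : ℕ → Set} → (∀ j → Dec (P j)) → ∀ b → P b → ∃ λ k → P k × (∀ j → P j → k ≤ j)
least {P} P? b pb with search (suc b)
  where
  search : ∀ b → (∃ λ k → P k × (∀ j → P j → k ≤ j)) ⊎ (∀ j → j < b → ¬ P j)
  search zero = inj₂ λ _ ()
  search (suc b) with search b
  ... | inj₁ found = inj₁ found
  ... | inj₂ none with P? b
  ...   | yes pb = inj₁ (b , pb , λ j pj → ℕ.≮⇒≥ λ j<b → none j j<b pj)
  ...   | no ¬pb = inj₂ below-suc
    where
    below-suc : ∀ j → j < suc b → ¬ P j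
    below-suc j j<1+b with ℕ.m<1+n⇒m<n∨m≡n j<1+b
    ... | inj₁ j<b  = none j j<b
    ... | inj₂ refl = ¬pb
... | inj₁ found = found
... | inj₂ none  = contradiction pb (none b (ℕ.n<1+n b))

anyFunction? : ∀ n {k} (P : (Fin n → Fin k) → Set) → (∀ {f g} → (∀ x → f x ≡ g x) → P f → P g) →
               (∀ f → Dec (P f)) → Dec (∃ P)
anyFunction? zero P resp P? with P? (λ ())
... | yes p = yes (_ , p)
... | no ¬p = no λ (f , pf) → ¬p (resp (λ ()) pf)
anyFunction? (suc n) P resp P?
  with any? (λ a → anyFunction? n (P ∘ (a ∷_)) (λ f≗g → resp λ { zero → refl ; (suc x) → f≗g x })
                                  (P? ∘ (a ∷_)))
... | yes (a , f , pf) = yes (a ∷ f , pf)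
... | no ¬p = no λ (f , pf) → ¬p (f zero , f ∘ suc , resp (λ { zero → refl ; (suc x) → refl }) pf)

colorable? : ∀ n (adj : Fin n → Fin n → Bool) k → Dec (Colorable (FinGraph n adj) k)
colorable? n adj k = anyFunction? n (IsColoring (FinGraph n adj) k) resp proper?
  where
  resp : ∀ {f g} → (∀ x → f x ≡ g x) → IsColoring (FinGraph n adj) k f → IsColoring (FinGraph n adj) k g
  resp f≗g proper u v uv e = proper u v uv (trans (f≗g u) (trans e (sym (f≗g v))))
  proper? : ∀ f → Dec (IsColoring (FinGraph n adj) k f)
  proper? f = all? λ u → all? λ v → (adj u v ≟ᵇ true) →-dec ¬? (f u ≟ᶠ f v)

chromaticNumber : ∀ n (adj : Fin n → Fin n → Bool) → (∀ v → adj v v ≡ false) →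
                  ∃ (IsChromaticNumber (FinGraph n adj))
chromaticNumber n adj irreflexive = least (colorable? n adj) n (id , distinct)
  where
  distinct : IsColoring (FinGraph n adj) n id
  distinct u v uv refl = contradiction (trans (sym (irreflexive u)) uv) λ ()

optimal-¬¬surjective : ∀ {G : Graph} {k} (t : Coloring G k) → (∀ j → Colorable G j → k ≤ j) →
                       ∀ i → ¬ (∀ x → proj₁ t x ≢ i)
optimal-¬¬surjective {G} {suc k} (t , proper) minimal i missed =
  ℕ.n≮n k (minimal k ((λ x → punchOut (missed x ∘ sym)) , proper′))
  where
  proper′ : IsColoring G k (λ x → punchOut (missed x ∘ sym))
  proper′ x y xy e = proper x y xy (punchOut-injective (missed x ∘ sym) (missed y ∘ sym) e)

does-true : ∀ {A : Set} (a? : Dec A) → does a? ≡ true → A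
does-true (yes a) _ = a

true-irrelevant : ∀ {b : Bool} (p q : b ≡ true) → p ≡ q
true-irrelevant = Decidable⇒UIP.≡-irrelevant _≟ᵇ_

anyInduced? : ∀ {n} (S : Fin n → Bool) {P : Σ (Fin n) (λ v → S v ≡ true) → Set} →
              (∀ x → Dec (P x)) → Dec (∃ P)
anyInduced? {n} S {P} P? with any? decideAt
  where
  decideAt : ∀ v → Dec (Σ (S v ≡ true) λ sv → P (v , sv))
  decideAt v with S v ≟ᵇ true
  ... | no ¬sv = no (¬sv ∘ proj₁)
  ... | yes sv with P? (v , sv)
  ...   | yes p = yes (sv , p)
  ...   | no ¬p = no λ (sv′ , p) → ¬p (subst (λ s → P (v , s)) (true-irrelevant sv′ sv) p)
... | yes (v , sv , p) = yes ((v , sv) , p)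
... | no none = no λ ((v , sv) , p) → none (v , sv , p)

optimal-surjective : ∀ {n adj} {S : Fin n → Bool} {k} (t : Coloring (Induced (FinGraph n adj) S) k) →
                     (∀ j → Colorable (Induced (FinGraph n adj) S) j → k ≤ j) →
                     ∀ i → ∃ λ x → proj₁ t x ≡ i
optimal-surjective {S = S} t minimal i with anyInduced? S (λ x → proj₁ t x ≟ᶠ i)
... | yes hit = hit
... | no none = contradiction (λ x e → none (x , e)) (optimal-¬¬surjective t minimal i)

restrict : ∀ {G : Graph} {ℓ} (S : V G → Bool) → Coloring G ℓ → Coloring (Induced G S) ℓ
restrict S (α , proper) = α ∘ proj₁ , λ x y → proper (proj₁ x) (proj₁ y)

compress : ∀ {G : Graph} {ℓ} (P : Fin ℓ → Bool) (α : Coloring G ℓ) → (∀ v → P (proj₁ α v) ≡ true) →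
           Coloring G (count P)
compress P (α , proper) α∈P = (λ v → index P (α v) (α∈P v)) , λ u v uv e →
  proper u v uv (trans (sym (enum-index P _ _)) (trans (cong (enum P) e) (enum-index P _ _)))

widen : ∀ {G : Graph} {k ℓ} → k ≤ ℓ → Coloring G k → Coloring G ℓ
widen k≤ℓ (α , proper) = (λ v → inject≤ (α v) k≤ℓ) , λ u v uv → proper u v uv ∘ inject≤-injective k≤ℓ k≤ℓ _ _

widen-misses : ∀ {G : Graph} {k ℓ} (k<ℓ : k < ℓ) (α : Coloring G k) v →
               proj₁ (widen (ℕ.<⇒≤ k<ℓ) α) v ≢ fromℕ< k<ℓ
widen-misses k<ℓ (α , _) v e = ℕ.<-irrefl
  (trans (sym (toℕ-inject≤ (α v) (ℕ.<⇒≤ k<ℓ))) (trans (cong toℕ e) (toℕ-fromℕ< k<ℓ))) (toℕ<n (α v))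

-- Reconfiguration walks

module _ (G : Graph) (ℓ : ℕ) where

  Step : Coloring G ℓ → Coloring G ℓ → Set
  Step α β = RAdj G ℓ α β ⊎ SameColoring G ℓ α β

  Walk : Coloring G ℓ → Coloring G ℓ → Set
  Walk = Star Step

  step-sym : ∀ {α β} → Step α β → Step β α
  step-sym (inj₁ (v , ne , same)) = inj₁ (v , ne ∘ sym , λ u u≢v → sym (same u u≢v))
  step-sym (inj₂ same)            = inj₂ (sym ∘ same)

  walk-sym : ∀ {α β} → Walk α β → Walk β α
  walk-sym = reverse (λ {α} {β} → step-sym {α} {β})

  ≈⇒walk : ∀ {α β} → SameColoring G ℓ α β → Walk α β
  ≈⇒walk same = inj₂ same ◅ ε

  step-at : DecidableEquality (V G) → ∀ {α β} x → (∀ y → y ≢ x → proj₁ α y ≡ proj₁ β y) → Step α β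
  step-at _≟_ {α} {β} x same-elsewhere with proj₁ α x ≟ᶠ proj₁ β x
  ... | no ne = inj₁ (x , ne , same-elsewhere)
  ... | yes e = inj₂ same
    where
    same : ∀ y → proj₁ α y ≡ proj₁ β y
    same y with y ≟ x
    ... | yes refl = e
    ... | no y≢x   = same-elsewhere y y≢x

  connected-through : (κ : Coloring G ℓ) → (∀ α → Walk α κ) → RConnected G ℓ
  connected-through κ to-κ α β = to-κ α ◅◅ walk-sym (to-κ β)

  step⇒compatible : DecidableEquality (V G) → ∀ {α β} → Step α β →
                    ∀ u v → E G u v → proj₁ α u ≢ proj₁ β v
  step⇒compatible _≟_ {α} {β} (inj₂ same) u v uv e = proj₂ α u v uv (trans e (sym (same v)))
  step⇒compatible _≟_ {α} {β} (inj₁ (x , _ , same)) u v uv e with v ≟ x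
  ... | no v≢x   = proj₂ α u v uv (trans e (sym (same v v≢x)))
  ... | yes refl = proj₂ β u v uv (trans (sym (same u u≢v)) e)
    where
    u≢v : u ≢ v
    u≢v u≡v = proj₂ α u v uv (cong (proj₁ α) u≡v)

module _ {A B : Set} (_≟_ : DecidableEquality A) where

  update : (A → B) → A → B → A → B
  update f x b y with y ≟ x
  ... | yes _ = b
  ... | no _  = f y

  update-at : ∀ f x b → update f x b x ≡ b
  update-at f x b with x ≟ x
  ... | yes _ = refl
  ... | no x≢x = contradiction refl x≢x

  update-elsewhere : ∀ f x b {y} → y ≢ x → update f x b y ≡ f y
  update-elsewhere f x b {y} y≢x with y ≟ x
  ... | yes y≡x = contradiction y≡x y≢x
  ... | no _    = refl

module Recoloring {G : Graph} (_≟_ : DecidableEquality (V G)) (E-sym : Symmetric (E G)) {ℓ : ℕ} where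

  recolor : (α : Coloring G ℓ) (x : V G) (a : Fin ℓ) → (∀ y → E G x y → proj₁ α y ≢ a) → Coloring G ℓ
  recolor (α , proper) x a free = update _≟_ α x a , proper′
    where
    proper′ : IsColoring G ℓ (update _≟_ α x a)
    proper′ u v uv with u ≟ x | v ≟ x
    ... | yes refl | yes refl = contradiction refl (proper u u uv)
    ... | yes refl | no _     = free v uv ∘ sym
    ... | no _     | yes refl = free u (E-sym uv)
    ... | no _     | no _     = proper u v uv

  recolor-at : ∀ α x a free → proj₁ (recolor α x a free) x ≡ a
  recolor-at α x a free = update-at _≟_ (proj₁ α) x a

  recolor-elsewhere : ∀ α x a free {y} → y ≢ x → proj₁ (recolor α x a free) y ≡ proj₁ α y
  recolor-elsewhere α x a free = update-elsewhere _≟_ (proj₁ α) x a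

  recolor-walk : ∀ α x a free → Walk G ℓ α (recolor α x a free)
  recolor-walk α x a free =
    step-at G ℓ _≟_ {α} {recolor α x a free} x (λ _ → sym ∘ recolor-elsewhere α x a free) ◅ ε

record InducedEmbedding (F G : Graph) : Set where
  field
    ι           : V F → V G
    ι-injective : ∀ {w w′} → ι w ≡ ι w′ → w ≡ w′
    locate      : ∀ v → (∃ λ w → ι w ≡ v) ⊎ (∀ w → ι w ≢ v)
    reflect     : ∀ {w w′} → E G (ι w) (ι w′) → E F w w′

module Patch {F G : Graph} (emb : InducedEmbedding F G) (E-sym : Symmetric (E G)) {k ℓ : ℕ}
  (β : Coloring G ℓ) (e : Fin k → Fin ℓ) (e-injective : ∀ {x y} → e x ≡ e y → x ≡ y)
  (avoids : ∀ v w → (∀ w′ → InducedEmbedding.ι emb w′ ≢ v) → E G v (InducedEmbedding.ι emb w) →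
            ∀ x → proj₁ β v ≢ e x) where

  open InducedEmbedding emb

  paint : (V F → Fin k) → ∀ v → (∃ λ w → ι w ≡ v) ⊎ (∀ w → ι w ≢ v) → Fin ℓ
  paint t v (inj₁ (w , _)) = e (t w)
  paint t v (inj₂ _)       = proj₁ β v

  patch : Coloring F k → Coloring G ℓ
  patch (t , proper) = (λ v → paint t v (locate v)) , proper′
    where
    proper′ : IsColoring G ℓ (λ v → paint t v (locate v))
    proper′ u v uv with locate u | locate v
    ... | inj₁ (w , refl) | inj₁ (w′ , refl) = proper w w′ (reflect uv) ∘ e-injective
    ... | inj₁ (w , refl) | inj₂ out         = avoids v w out (E-sym uv) (t w) ∘ sym
    ... | inj₂ out        | inj₁ (w , refl)  = avoids u w out uv (t w)
    ... | inj₂ _          | inj₂ _           = proj₂ β u v uv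

  patch-inside : ∀ t w → proj₁ (patch t) (ι w) ≡ e (proj₁ t w)
  patch-inside t w with locate (ι w)
  ... | inj₁ (w′ , eq) = cong (e ∘ proj₁ t) (ι-injective eq)
  ... | inj₂ out       = contradiction refl (out w)

  patch-outside : ∀ t {v} → (∀ w → ι w ≢ v) → proj₁ (patch t) v ≡ proj₁ β v
  patch-outside t {v} out with locate v
  ... | inj₁ (w , eq) = contradiction eq (out w)
  ... | inj₂ _        = refl

  patch-step : ∀ {t t′} → Step F k t t′ → Step G ℓ (patch t) (patch t′)
  patch-step {t} {t′} (inj₁ (w , ne , same)) = inj₁ (ι w , ne′ , same′)
    where
    ne′ : proj₁ (patch t) (ι w) ≢ proj₁ (patch t′) (ι w)
    ne′ eq = ne (e-injective (trans (sym (patch-inside t w)) (trans eq (patch-inside t′ w))))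
    same′ : ∀ v → v ≢ ι w → proj₁ (patch t) v ≡ proj₁ (patch t′) v
    same′ v v≢ιw with locate v
    ... | inj₁ (w′ , refl) = cong e (same w′ (v≢ιw ∘ cong ι))
    ... | inj₂ _           = refl
  patch-step {t} {t′} (inj₂ same) = inj₂ same′
    where
    same′ : ∀ v → proj₁ (patch t) v ≡ proj₁ (patch t′) v
    same′ v with locate v
    ... | inj₁ (w , _) = cong e (same w)
    ... | inj₂ _       = refl

  patch-walk : ∀ {t t′} → Walk F k t t′ → Walk G ℓ (patch t) (patch t′)
  patch-walk = gmap patch (λ {t} {t′} → patch-step {t} {t′})

inducedEmbedding : ∀ {G : Graph} (S : V G → Bool) → InducedEmbedding (Induced G S) G
inducedEmbedding {G} S = record
  { ι           = proj₁
  ; ι-injective = ι-injective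
  ; locate      = λ v → locate v (S v) refl
  ; reflect     = id
  }
  where
  ι-injective : ∀ {w w′ : V (Induced G S)} → proj₁ w ≡ proj₁ w′ → w ≡ w′
  ι-injective {v , v∈} {.v , v∈′} refl = cong (v ,_) (true-irrelevant v∈ v∈′)
  locate : ∀ v b → S v ≡ b →
           (∃ λ (w : V (Induced G S)) → proj₁ w ≡ v) ⊎ (∀ (w : V (Induced G S)) → proj₁ w ≢ v)
  locate v true  v∈ = inj₁ ((v , v∈) , refl)
  locate v false v∉ = inj₂ λ { (w , w∈) refl → contradiction (trans (sym w∈) v∉) λ () }

module Interpolation {V X : Set} {N : ℕ} (block : V → Fin N) (f g : V → X) where

  interpolate : ℕ → V → X
  interpolate j v with toℕ (block v) <? j
  ... | yes _ = g v
  ... | no _  = f v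

  interpolate-done : ∀ {j v} → toℕ (block v) < j → interpolate j v ≡ g v
  interpolate-done {j} {v} lt with toℕ (block v) <? j
  ... | yes _  = refl
  ... | no ¬lt = contradiction lt ¬lt

  interpolate-todo : ∀ {j v} → ¬ toℕ (block v) < j → interpolate j v ≡ f v
  interpolate-todo {j} {v} ¬lt with toℕ (block v) <? j
  ... | yes lt = contradiction lt ¬lt
  ... | no _   = refl

  interpolate-either : ∀ j v → interpolate j v ≡ f v ⊎ interpolate j v ≡ g v
  interpolate-either j v with toℕ (block v) <? j
  ... | yes _ = inj₂ refl
  ... | no _  = inj₁ refl

  interpolate-zero : ∀ v → interpolate 0 v ≡ f v
  interpolate-zero v = interpolate-todo {0} λ ()

  interpolate-full : ∀ v → interpolate N v ≡ g v
  interpolate-full v = interpolate-done (toℕ<n (block v))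

  interpolate-before : ∀ {b v} → block v ≡ b → interpolate (toℕ b) v ≡ f v
  interpolate-before refl = interpolate-todo (ℕ.n≮n _)

  interpolate-after : ∀ {b v} → block v ≡ b → interpolate (suc (toℕ b)) v ≡ g v
  interpolate-after refl = interpolate-done (ℕ.n<1+n _)

  interpolate-elsewhere : ∀ {b v} → block v ≢ b → interpolate (toℕ b) v ≡ interpolate (suc (toℕ b)) v
  interpolate-elsewhere {b} {v} ne with toℕ (block v) <? toℕ b | toℕ (block v) <? suc (toℕ b)
  ... | yes _  | yes _ = refl
  ... | no _   | no _  = refl
  ... | yes lt | no ¬lt = contradiction (ℕ.m<n⇒m<1+n lt) ¬lt
  ... | no ¬lt | yes lt with ℕ.m<1+n⇒m<n∨m≡n lt
  ...   | inj₁ lt′ = contradiction lt′ ¬lt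
  ...   | inj₂ eq  = contradiction (toℕ-injective eq) ne

module BlockWalk {G : Graph} (E-sym : Symmetric (E G)) {ℓ N : ℕ} (block : V G → Fin N) (α β : Coloring G ℓ)
  (compatible : ∀ u v → E G u v → block u ≢ block v → proj₁ α u ≢ proj₁ β v) where

  open Interpolation block (proj₁ α) (proj₁ β) public

  stage : ℕ → Coloring G ℓ
  stage j = interpolate j , proper
    where
    proper : IsColoring G ℓ (interpolate j)
    proper u v uv with toℕ (block u) <? j | toℕ (block v) <? j
    ... | yes _  | yes _  = proj₂ β u v uv
    ... | no _   | no _   = proj₂ α u v uv
    ... | yes lt | no ¬lt = compatible v u (E-sym uv) (λ e → ¬lt (subst (λ b → toℕ b < j) (sym e) lt)) ∘ sym
    ... | no ¬lt | yes lt = compatible u v uv (λ e → ¬lt (subst (λ b → toℕ b < j) (sym e) lt))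

  walk-by-blocks : (∀ b → Walk G ℓ (stage (toℕ b)) (stage (suc (toℕ b)))) → Walk G ℓ α β
  walk-by-blocks step =
    ≈⇒walk G ℓ {α} {stage 0} (sym ∘ interpolate-zero) ◅◅ up-to N ℕ.≤-refl ◅◅
    ≈⇒walk G ℓ {stage N} {β} interpolate-full
    where
    up-to : ∀ j → j ≤ N → Walk G ℓ (stage 0) (stage j)
    up-to zero    _   = ε
    up-to (suc j) j<N = up-to j (ℕ.<⇒≤ j<N) ◅◅
      subst (λ i → Walk G ℓ (stage i) (stage (suc i))) (toℕ-fromℕ< j<N) (step (fromℕ< j<N))

  -- Block b is the image of an induced copy of F whose outside neighbours avoid the palette e;
  -- a walk recoloring that copy within e carries stage b to stage b + 1.
  walk-within-block : ∀ {F : Graph} {k} (b : Fin N) (emb : InducedEmbedding F G) →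
    let open InducedEmbedding emb in
    (∀ w → block (ι w) ≡ b) → (∀ v → block v ≡ b → ∃ λ w → ι w ≡ v) →
    (e : Fin k → Fin ℓ) → (∀ {x y} → e x ≡ e y → x ≡ y) →
    (∀ v w → (∀ w′ → ι w′ ≢ v) → E G v (ι w) → ∀ x → interpolate (toℕ b) v ≢ e x) →
    (t t′ : Coloring F k) → (∀ w → e (proj₁ t w) ≡ proj₁ α (ι w)) → (∀ w → e (proj₁ t′ w) ≡ proj₁ β (ι w)) →
    Walk F k t t′ → Walk G ℓ (stage (toℕ b)) (stage (suc (toℕ b)))
  walk-within-block b emb in-block covers e e-injective avoids t t′ t≈α t′≈β t→t′ =
    ≈⇒walk G ℓ {stage (toℕ b)} {patch t} before ◅◅ patch-walk t→t′ ◅◅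
    ≈⇒walk G ℓ {patch t′} {stage (suc (toℕ b))} after
    where
    open InducedEmbedding emb
    open Patch emb E-sym (stage (toℕ b)) e e-injective avoids
    outside : ∀ {v} → (∀ w → ι w ≢ v) → block v ≢ b
    outside out e = out (proj₁ (covers _ e)) (proj₂ (covers _ e))
    before : ∀ v → interpolate (toℕ b) v ≡ proj₁ (patch t) v
    before v = by-cases (locate v)
      where
      by-cases : (∃ λ w → ι w ≡ v) ⊎ (∀ w → ι w ≢ v) → interpolate (toℕ b) v ≡ proj₁ (patch t) v
      by-cases (inj₁ (w , refl)) =
        trans (interpolate-before (in-block w)) (trans (sym (t≈α w)) (sym (patch-inside t w)))
      by-cases (inj₂ out) = sym (patch-outside t out)
    after : ∀ v → proj₁ (patch t′) v ≡ interpolate (suc (toℕ b)) v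
    after v = by-cases (locate v)
      where
      by-cases : (∃ λ w → ι w ≡ v) ⊎ (∀ w → ι w ≢ v) → proj₁ (patch t′) v ≡ interpolate (suc (toℕ b)) v
      by-cases (inj₁ (w , refl)) =
        trans (patch-inside t′ w) (trans (t′≈β w) (sym (interpolate-after (in-block w))))
      by-cases (inj₂ out)        = trans (patch-outside t′ out) (interpolate-elsewhere (outside out))

FinGraph-sym : ∀ {n} {adj : Fin n → Fin n → Bool} → (∀ u v → adj u v ≡ adj v u) →
               Symmetric (E (FinGraph n adj))
FinGraph-sym adj-sym {u} {v} uv = trans (adj-sym v u) uv

compatible-walk : ∀ {n adj ℓ} → (∀ u v → adj u v ≡ adj v u) → (α β : Coloring (FinGraph n adj) ℓ) →
                  (∀ u v → adj u v ≡ true → proj₁ α u ≢ proj₁ β v) → Walk (FinGraph n adj) ℓ α β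
compatible-walk {n} {adj} {ℓ} adj-sym α β compatible =
  walk-by-blocks λ b →
    step-at _ ℓ _≟ᶠ_ {stage (toℕ b)} {stage (suc (toℕ b))} b (λ _ → interpolate-elsewhere) ◅ ε
  where open BlockWalk (FinGraph-sym adj-sym) id α β (λ u v uv _ → compatible u v uv)

-- Complete graphs

CompleteGraph : ℕ → Graph
CompleteGraph c = mkGraph (Fin c) _≢_

CompleteGraph-sym : ∀ {c} → Symmetric (E (CompleteGraph c))
CompleteGraph-sym ne = ne ∘ sym

recolor-complete : ∀ {c} (f : Coloring (CompleteGraph c) (suc c)) x a →
                   ∃ λ f′ → Walk (CompleteGraph c) (suc c) f f′ × proj₁ f′ x ≡ a
recolor-complete {c} f x a = by-cases (any? λ k → (proj₁ f k ≟ᶠ a) ×-dec ¬? (k ≟ᶠ x))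
  where
  open Recoloring _≟ᶠ_ (CompleteGraph-sym {c})

  by-cases : Dec (∃ λ k → proj₁ f k ≡ a × k ≢ x) →
             ∃ λ f′ → Walk (CompleteGraph c) (suc c) f f′ × proj₁ f′ x ≡ a
  by-cases (no none) = recolor f x a free , recolor-walk f x a free , recolor-at f x a free
    where
    free : ∀ j → x ≢ j → proj₁ f j ≢ a
    free j x≢j f[j]≡a = none (j , f[j]≡a , x≢j ∘ sym)
  by-cases (yes (k , f[k]≡a , k≢x)) =
    recolor f′ x a free , recolor-walk f k y y-free ◅◅ recolor-walk f′ x a free , recolor-at f′ x a free
    where
    spare = missed-value (proj₁ f) (ℕ.n<1+n c)
    y = proj₁ spare
    y-free : ∀ j → k ≢ j → proj₁ f j ≢ y
    y-free j _ = proj₂ spare j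
    f′ = recolor f k y y-free
    free : ∀ j → x ≢ j → proj₁ f′ j ≢ a
    free j _ = j-free (j ≟ᶠ k)
      where
      j-free : Dec (j ≡ k) → proj₁ f′ j ≢ a
      j-free (yes refl) f′[k]≡a =
        proj₂ spare k (trans f[k]≡a (trans (sym f′[k]≡a) (recolor-at f k y y-free)))
      j-free (no j≢k)   f′[j]≡a = proj₂ f j k j≢k
        (trans (sym (recolor-elsewhere f k y y-free j≢k)) (trans f′[j]≡a (sym f[k]≡a)))

sucEmbedding : ∀ {c} → InducedEmbedding (CompleteGraph c) (CompleteGraph (suc c))
sucEmbedding = record
  { ι           = suc
  ; ι-injective = suc-injective
  ; locate      = λ { zero → inj₂ λ _ () ; (suc w) → inj₁ (w , refl) }
  ; reflect     = λ ne → ne ∘ cong suc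
  }

-- Once vertex 0 has its target color a, the other vertices use the c + 1 colors
-- other than a, so the remaining recoloring happens in K_c through punchIn a.
complete-recolorable : ∀ c → RConnected (CompleteGraph c) (suc c)
complete-recolorable zero f g = ≈⇒walk _ _ {f} {g} λ ()
complete-recolorable (suc c) f g with recolor-complete f zero (proj₁ g zero)
... | f₁ , f→f₁ , f₁[0]≡a =
  f→f₁ ◅◅ ≈⇒walk _ _ {f₁} {patch (tail f₁ f₁[0]≡a)} (sym ∘ patch-tail f₁ f₁[0]≡a) ◅◅
  patch-walk (complete-recolorable c (tail f₁ f₁[0]≡a) (tail g refl)) ◅◅
  ≈⇒walk _ _ {patch (tail g refl)} {g} (patch-tail g refl)
  where
  a = proj₁ g zero
  K = CompleteGraph (suc c)

  tail : (h : Coloring K (suc (suc c))) → proj₁ h zero ≡ a → Coloring (CompleteGraph c) (suc c)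
  tail h h[0]≡a = (λ i → punchOut (a≢ i)) , λ i j i≢j →
                    proj₂ h (suc i) (suc j) (i≢j ∘ suc-injective) ∘ punchOut-injective (a≢ i) (a≢ j)
    where
    a≢ : ∀ i → a ≢ proj₁ h (suc i)
    a≢ i e = proj₂ h zero (suc i) (λ ()) (trans h[0]≡a e)

  avoids : ∀ v w → (∀ w′ → suc w′ ≢ v) → v ≢ suc w → ∀ x → proj₁ f₁ v ≢ punchIn a x
  avoids zero    _ _   _ x e = punchInᵢ≢i a x (trans (sym e) f₁[0]≡a)
  avoids (suc v) _ out _ _ _ = out v refl

  open Patch sucEmbedding CompleteGraph-sym f₁ (punchIn a) (punchIn-injective a _ _) avoids

  patch-tail : ∀ h h[0]≡a v → proj₁ (patch (tail h h[0]≡a)) v ≡ proj₁ h v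
  patch-tail h h[0]≡a zero    = trans (patch-outside (tail h h[0]≡a) λ _ ()) (trans f₁[0]≡a (sym h[0]≡a))
  patch-tail h h[0]≡a (suc i) = trans (patch-inside (tail h h[0]≡a) i) (punchIn-punchOut _)

-- The clique skeleton

module Skeleton (n : ℕ) (adj : Fin n → Fin n → Bool) (adj-sym : ∀ u v → adj u v ≡ adj v u)
  (m : ℕ) (part : Fin n → Fin m) (modules : ∀ p → IsModule (FinGraph n adj) (Part part p))
  (c : Fin m → ℕ) (χ-part : ∀ p → IsChromaticNumber (Induced (FinGraph n adj) (Part part p)) (c p)) where

  G : Graph
  G = FinGraph n adj

  H : Graph
  H = CliqueSkeleton n adj m part c

  G[_] : Fin m → Graph
  G[ p ] = Induced G (Part part p)

  ∈part : ∀ {v p} → part v ≡ p → Part part p v ≡ true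
  ∈part {v} {p} = dec-true (part v ≟ᶠ p)

  ∈part⁻ : ∀ {v p} → Part part p v ≡ true → part v ≡ p
  ∈part⁻ {v} {p} = does-true (part v ≟ᶠ p)

  ∉part : ∀ {v p} → part v ≢ p → Part part p v ≡ false
  ∉part {v} {p} = dec-false (part v ≟ᶠ p)

  ∉part⇒outside : ∀ {v p} → part v ≢ p → ∀ (w : V G[ p ]) → proj₁ w ≢ v
  ∉part⇒outside v∉p (w , w∈p) refl = v∉p (∈part⁻ w∈p)

  outside⇒∉part : ∀ {v p} → (∀ (w : V G[ p ]) → proj₁ w ≢ v) → part v ≢ p
  outside⇒∉part {v} out v∈p = out (v , ∈part v∈p) refl

  neighbour-of-part : ∀ {p} w u x → part w ≢ p → part u ≡ p → adj w u ≡ true → part x ≡ p → adj w x ≡ true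
  neighbour-of-part {p} w u x w∉p u∈p wu x∈p with proj₂ (modules p) w (∉part w∉p)
  ... | inj₁ complete     = complete x (∈part x∈p)
  ... | inj₂ anticomplete = contradiction wu (anticomplete u (∈part u∈p))

  adjacent⇒complete : ∀ {u w} → adj u w ≡ true → part u ≢ part w → Complete n adj part (part u) (part w)
  adjacent⇒complete {u} {w} uw ne u′ w′ u′∈ w′∈ =
    neighbour-of-part u′ w w′ (ne ∘ trans (sym (∈part⁻ u′∈))) refl
      (trans (adj-sym u′ w) (neighbour-of-part w u u′ (ne ∘ sym) refl (trans (adj-sym w u) uw) (∈part⁻ u′∈)))
      (∈part⁻ w′∈)

  H-sym : Symmetric (E H)
  H-sym (inj₁ (refl , ne)) = inj₁ (refl , ne ∘ sym)
  H-sym (inj₂ (ne , complete)) = inj₂ (ne ∘ sym , λ u v u∈ v∈ → trans (adj-sym u v) (complete v u v∈ u∈))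

  _≟H_ : DecidableEquality (V H)
  _≟H_ = ≡-dec _≟ᶠ_ _≟ᶠ_

  open Recoloring _≟H_ (λ {x} {y} → H-sym {x} {y})

  cross-complete : ∀ {p q i j} → E H (p , i) (q , j) → p ≢ q → Complete n adj part p q
  cross-complete (inj₁ (p≡q , _))     p≢q = contradiction p≡q p≢q
  cross-complete (inj₂ (_ , complete)) _  = complete

  in-clique : ∀ {p q} → q ≡ p → (i : Fin (c q)) → ∃ λ j → _≡_ {A = V H} (q , i) (p , j)
  in-clique refl i = i , refl

  clique-injective : ∀ {ℓ} (δ : Coloring H ℓ) {p i j} → proj₁ δ (p , i) ≡ proj₁ δ (p , j) → i ≡ j
  clique-injective δ {p} {i} {j} e with i ≟ᶠ j
  ... | yes i≡j = i≡j
  ... | no i≢j  = contradiction e (proj₂ δ (p , i) (p , j) (inj₁ (refl , i≢j ∘ toℕ-injective)))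

  Shape : Set
  Shape = (p : Fin m) → Coloring G[ p ] (c p)

  π : Shape → Fin n → V H
  π s v = part v , proj₁ (s (part v)) (v , ∈part refl)

  π-in : ∀ s {p} (x : V G[ p ]) → π s (proj₁ x) ≡ (p , proj₁ (s p) x)
  π-in s {p} (v , v∈p) = lemma (∈part⁻ v∈p) (∈part refl) v∈p
    where
    lemma : ∀ {q} (q≡p : q ≡ p) (v∈q : Part part q v ≡ true) (v∈p : Part part p v ≡ true) →
            _≡_ {A = V H} (q , proj₁ (s q) (v , v∈q)) (p , proj₁ (s p) (v , v∈p))
    lemma refl v∈q v∈p = cong (λ v∈ → _ , proj₁ (s _) (v , v∈)) (true-irrelevant v∈q v∈p)

  π-hom : ∀ s u v → adj u v ≡ true → E H (π s u) (π s v)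
  π-hom s u v uv with part u ≟ᶠ part v
  ... | no ne = inj₂ (ne , adjacent⇒complete uv ne)
  ... | yes eq = inj₁ (eq , same-part eq (∈part refl) (∈part refl))
    where
    same-part : ∀ {p q} (p≡q : p ≡ q) u∈p v∈q → toℕ (proj₁ (s p) (u , u∈p)) ≢ toℕ (proj₁ (s q) (v , v∈q))
    same-part refl u∈p v∈q = proj₂ (s _) (u , u∈p) (v , v∈q) uv ∘ toℕ-injective

  pullback : ∀ {ℓ} → Shape → Coloring H ℓ → Coloring G ℓ
  pullback s (γ , proper) = γ ∘ π s , λ u v uv → proper (π s u) (π s v) (π-hom s u v uv)

  pullback-walk : ∀ {ℓ} s {γ γ′ : Coloring H ℓ} → Walk H ℓ γ γ′ → Walk G ℓ (pullback s γ) (pullback s γ′)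
  pullback-walk {ℓ} s = kleisliStar (pullback s) λ {γ} {γ′} st →
    compatible-walk adj-sym (pullback s γ) (pullback s γ′) λ u v uv →
      step⇒compatible H ℓ _≟H_ {γ} {γ′} st (π s u) (π s v) (π-hom s u v uv)

  Used : ∀ {ℓ} → (Fin n → Fin ℓ) → Fin m → Fin ℓ → Bool
  Used β p x = does (any? λ v → (part v ≟ᶠ p) ×-dec (β v ≟ᶠ x))

  used⁺ : ∀ {ℓ} (β : Fin n → Fin ℓ) {p} v → part v ≡ p → Used β p (β v) ≡ true
  used⁺ β v v∈p = dec-true (any? _) (v , v∈p , refl)

  used⁻ : ∀ {ℓ} (β : Fin n → Fin ℓ) {p x} → Used β p x ≡ true → ∃ λ v → part v ≡ p × β v ≡ x
  used⁻ β = does-true (any? _)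

  χ-part-minimal : ∀ p {k} → Colorable G[ p ] k → c p ≤ k
  χ-part-minimal p = proj₂ (χ-part p) _

  used-bound : ∀ {ℓ} (β : Coloring G ℓ) p → c p ≤ count (Used (proj₁ β) p)
  used-bound β p = χ-part-minimal p
    (compress (Used (proj₁ β) p) (restrict (Part part p) β) λ (v , v∈p) → used⁺ (proj₁ β) v (∈part⁻ v∈p))

  skeletonColoring : ∀ {k} → Coloring G k → Coloring H k
  skeletonColoring {k} κ = color , proper
    where
    color : V H → Fin k
    color (p , i) = enum (Used (proj₁ κ) p) (inject≤ i (used-bound κ p))
    proper : IsColoring H k color
    proper (p , i) (.p , j) (inj₁ (refl , ne)) e =
      ne (cong toℕ (inject≤-injective _ _ i j (enum-injective (Used (proj₁ κ) p) e)))
    proper (p , i) (q , j) (inj₂ (_ , complete)) e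
      with used⁻ (proj₁ κ) (enum-sat (Used (proj₁ κ) p) _) | used⁻ (proj₁ κ) (enum-sat (Used (proj₁ κ) q) _)
    ... | u , u∈p , κu | w , w∈q , κw =
      proj₂ κ u w (complete u w (∈part u∈p) (∈part w∈q)) (trans κu (trans e (sym κw)))

  record SpareColoring (ℓ : ℕ) : Set where
    field
      coloring : Coloring H ℓ
      spare     : Fin ℓ
      unused    : ∀ y → proj₁ coloring y ≢ spare

    palette : (p : Fin m) → Fin (suc (c p)) → Fin ℓ
    palette p zero    = spare
    palette p (suc i) = proj₁ coloring (p , i)

    palette-injective : ∀ p {x y} → palette p x ≡ palette p y → x ≡ y
    palette-injective p {zero}  {zero}  _ = refl
    palette-injective p {zero}  {suc j} e = contradiction (sym e) (unused _)
    palette-injective p {suc i} {zero}  e = contradiction e (unused _)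
    palette-injective p {suc i} {suc j} e = cong suc (clique-injective coloring e)

    palette-fresh : ∀ {p q} i → q ≢ p → Complete n adj part q p → ∀ x → proj₁ coloring (q , i) ≢ palette p x
    palette-fresh i q≢p complete zero    = unused _
    palette-fresh i q≢p complete (suc j) = proj₂ coloring _ _ (inj₂ (q≢p , complete))

  referenceColoring : ∀ {k ℓ} → k < ℓ → Coloring G k → SpareColoring ℓ
  referenceColoring k<ℓ κ = record
    { coloring = widen (ℕ.<⇒≤ k<ℓ) (skeletonColoring κ)
    ; spare     = fromℕ< k<ℓ
    ; unused    = widen-misses k<ℓ (skeletonColoring κ)
    }

  outside-complete : ∀ {p} v w → part w ≡ p → part v ≢ p → adj v w ≡ true → Complete n adj part (part v) p
  outside-complete v w w∈p v∉p vw =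
    subst (Complete n adj part (part v)) w∈p (adjacent⇒complete vw (v∉p ∘ flip trans w∈p))

  fiber-walk : ∀ {ℓ} → (∀ p → RConnected G[ p ] (suc (c p))) → (sc : SpareColoring ℓ) →
               ∀ s s′ → let open SpareColoring sc in Walk G ℓ (pullback s coloring) (pullback s′ coloring)
  fiber-walk recolorable sc s s′ = walk-by-blocks λ p →
    walk-within-block p (inducedEmbedding (Part part p)) (∈part⁻ ∘ proj₂) (λ v v∈p → (v , ∈part v∈p) , refl)
      (palette p) (palette-injective p) (avoids p) (lift s p) (lift s′ p) (lift-agrees s p) (lift-agrees s′ p)
      (recolorable p (lift s p) (lift s′ p))
    where
    open SpareColoring sc
    compatible : ∀ u v → adj u v ≡ true → part u ≢ part v → proj₁ coloring (π s u) ≢ proj₁ coloring (π s′ v)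
    compatible u v uv ne = proj₂ coloring _ _ (inj₂ (ne , adjacent⇒complete uv ne))
    open BlockWalk (FinGraph-sym adj-sym) part (pullback s coloring) (pullback s′ coloring) compatible

    lift : Shape → ∀ p → Coloring G[ p ] (suc (c p))
    lift s p = suc ∘ proj₁ (s p) , λ x y xy → proj₂ (s p) x y xy ∘ suc-injective

    lift-agrees : ∀ s p (x : V G[ p ]) → palette p (proj₁ (lift s p) x) ≡ proj₁ coloring (π s (proj₁ x))
    lift-agrees s p x = cong (proj₁ coloring) (sym (π-in s x))

    avoids : ∀ p v (w : V G[ p ]) → (∀ w′ → proj₁ w′ ≢ v) → adj v (proj₁ w) ≡ true →
             ∀ x → interpolate (toℕ p) v ≢ palette p x
    avoids p v (w , w∈p) out vw x e =
      let i , stage≡ = stage-in-reference in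
      palette-fresh i v∉p (outside-complete v w (∈part⁻ w∈p) v∉p vw) x (trans (sym stage≡) e)
      where
      v∉p = outside⇒∉part out
      stage-in-reference : ∃ λ i → interpolate (toℕ p) v ≡ proj₁ coloring (part v , i)
      stage-in-reference = [ _ ,_ , _ ,_ ]′ (interpolate-either (toℕ p) v)

  record Factorization {ℓ} (β : Fin n → Fin ℓ) (p : Fin m) : Set where
    field
      colors           : Fin (c p) → Fin ℓ
      colors-injective : ∀ {i j} → colors i ≡ colors j → i ≡ j
      shape             : Coloring G[ p ] (c p)
      factors           : ∀ x → β (proj₁ x) ≡ colors (proj₁ shape x)

  factorization-resp : ∀ {ℓ p} {β β′ : Fin n → Fin ℓ} → (∀ (x : V G[ p ]) → β′ (proj₁ x) ≡ β (proj₁ x)) →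
                       Factorization β p → Factorization β′ p
  factorization-resp β′≈β F = record
    { colors = colors ; colors-injective = colors-injective ; shape = shape
    ; factors = λ x → trans (β′≈β x) (factors x) }
    where open Factorization F

  exact-factorization : ∀ {ℓ p k} {β : Fin n → Fin ℓ} → c p ≡ k →
                        (t : Coloring G[ p ] k) (e : Fin k → Fin ℓ) → (∀ {i j} → e i ≡ e j → i ≡ j) →
                        (∀ x → β (proj₁ x) ≡ e (proj₁ t x)) → Factorization β p
  exact-factorization refl t e e-injective factors = record
    { colors = e ; colors-injective = e-injective ; shape = t ; factors = factors }

  record PartNormalization {ℓ} (β : Coloring G ℓ) (p : Fin m) : Set where
    field
      result        : Coloring G ℓ
      walk          : Walk G ℓ β result
      unchanged     : ∀ v → part v ≢ p → proj₁ result v ≡ proj₁ β v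
      factorization : Factorization (proj₁ result) p

  module FreeColors {ℓ} (β : Coloring G ℓ) (p : Fin m) where

    OnBoundary : Fin ℓ → Set
    OnBoundary x = ∃ λ w → ∃ λ u → part w ≢ p × part u ≡ p × adj w u ≡ true × proj₁ β w ≡ x

    onBoundary? : ∀ x → Dec (OnBoundary x)
    onBoundary? x = any? λ w → any? λ u →
      ¬? (part w ≟ᶠ p) ×-dec (part u ≟ᶠ p) ×-dec (adj w u ≟ᵇ true) ×-dec (proj₁ β w ≟ᶠ x)

    Free : Fin ℓ → Bool
    Free x = does (¬? (onBoundary? x))

    inside-free : ∀ (x : V G[ p ]) → Free (proj₁ β (proj₁ x)) ≡ true
    inside-free (v , v∈p) = dec-true (¬? (onBoundary? _)) λ (w , u , w∉p , u∈p , wu , e) →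
      proj₂ β w v (neighbour-of-part w u v w∉p u∈p wu (∈part⁻ v∈p)) e

    free-avoids-boundary : ∀ v (w : V G[ p ]) → (∀ w′ → proj₁ w′ ≢ v) → adj v (proj₁ w) ≡ true →
                           ∀ x → proj₁ β v ≢ enum Free x
    free-avoids-boundary v (u , u∈p) out vu x e =
      does-true (¬? (onBoundary? _)) (enum-sat Free x) (v , u , outside⇒∉part out , ∈part⁻ u∈p , vu , e)

  normalize-part : ∀ {ℓ} → (∀ p → Recolorable G[ p ]) → (β : Coloring G ℓ) (p : Fin m) →
                   PartNormalization β p
  normalize-part {ℓ} recolorable β p = choose (ℕ.m≤n⇒m<n∨m≡n (χ-part-minimal p (_ , proj₂ restricted)))
    where
    open FreeColors β p

    restricted : Coloring G[ p ] (count Free)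
    restricted = compress Free (restrict (Part part p) β) inside-free

    open Patch (inducedEmbedding (Part part p)) (FinGraph-sym adj-sym) β
               (enum Free) (enum-injective Free) free-avoids-boundary

    β≈patch : ∀ v → proj₁ β v ≡ proj₁ (patch restricted) v
    β≈patch v = by-cases (part v ≟ᶠ p)
      where
      by-cases : Dec (part v ≡ p) → proj₁ β v ≡ proj₁ (patch restricted) v
      by-cases (yes v∈p) = sym (trans (patch-inside restricted (v , ∈part v∈p)) (enum-index Free _ _))
      by-cases (no v∉p)  = sym (patch-outside restricted (∉part⇒outside v∉p))

    choose : c p < count Free ⊎ c p ≡ count Free → PartNormalization β p
    choose (inj₂ c≡k) = record
      { result        = β
      ; walk          = ε
      ; unchanged     = λ _ _ → refl
      ; factorization = exact-factorization c≡k restricted (enum Free) (enum-injective Free)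
                          λ x → sym (enum-index Free _ _)
      }
    choose (inj₁ c<k) = record
      { result        = patch optimal
      ; walk          = ≈⇒walk G ℓ {β} {patch restricted} β≈patch ◅◅
                        patch-walk (recolorable p (c p) (χ-part p) (count Free) c<k restricted optimal)
      ; unchanged     = λ v v∉p → patch-outside optimal (∉part⇒outside v∉p)
      ; factorization = exact-factorization refl (proj₁ (χ-part p)) (enum Free ∘ λ i → inject≤ i (ℕ.<⇒≤ c<k))
                          (inject≤-injective _ _ _ _ ∘ enum-injective Free) (patch-inside optimal)
      }
      where
      optimal = widen (ℕ.<⇒≤ c<k) (proj₁ (χ-part p))

  normalize : ∀ {ℓ} → (∀ p → Recolorable G[ p ]) → (β : Coloring G ℓ) →
              ∃ λ β′ → Walk G ℓ β β′ × (∀ p → Factorization (proj₁ β′) p)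
  normalize recolorable β with normalize-below m ℕ.≤-refl
    where
    normalize-below : ∀ j → j ≤ m → ∃ λ β′ → Walk G _ β β′ × (∀ p → toℕ p < j → Factorization (proj₁ β′) p)
    normalize-below zero    _   = β , ε , λ _ ()
    normalize-below (suc j) j<m with normalize-below j (ℕ.<⇒≤ j<m)
    ... | β₁ , β→β₁ , below-j = result , β→β₁ ◅◅ walk , below-suc-j
      where
      open PartNormalization (normalize-part recolorable β₁ (fromℕ< j<m))
      below-suc-j : ∀ q → toℕ q < suc j → Factorization (proj₁ result) q
      below-suc-j q q<1+j with ℕ.m<1+n⇒m<n∨m≡n q<1+j
      ... | inj₂ q≡j =
        subst (Factorization _) (toℕ-injective (trans (toℕ-fromℕ< j<m) (sym q≡j))) factorization
      ... | inj₁ q<j = factorization-resp (λ (v , v∈q) → unchanged v λ v∈j → ℕ.<-irrefl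
                         (trans (cong toℕ (trans (sym (∈part⁻ v∈q)) v∈j)) (toℕ-fromℕ< j<m)) q<j)
                         (below-j q q<j)
  ... | β′ , β→β′ , below-m = β′ , β→β′ , λ p → below-m p (toℕ<n p)

  factored⇒pullback : ∀ {ℓ} (β : Coloring G ℓ) → (∀ p → Factorization (proj₁ β) p) →
                      ∃ λ γ → ∃ λ s → ∀ v → proj₁ β v ≡ proj₁ (pullback {ℓ} s γ) v
  factored⇒pullback {ℓ} β F = (color , proper) , shape ∘ F , λ v → factors (F (part v)) (v , ∈part refl)
    where
    open Factorization
    color : V H → Fin ℓ
    color (p , i) = colors (F p) i
    realised : ∀ p i → ∃ λ (x : V G[ p ]) → proj₁ (shape (F p)) x ≡ i
    realised p = optimal-surjective (shape (F p)) (proj₂ (χ-part p))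
    proper : IsColoring H ℓ color
    proper (p , i) (.p , j) (inj₁ (refl , ne)) e = ne (cong toℕ (colors-injective (F p) e))
    proper (p , i) (q , j) (inj₂ (_ , complete)) e with realised p i | realised q j
    ... | (u , u∈p) , refl | (w , w∈q) , refl = proj₂ β u w (complete u w u∈p w∈q)
      (trans (factors (F p) (u , u∈p)) (trans e (sym (factors (F q) (w , w∈q)))))

  optimalShape : Shape
  optimalShape p = proj₁ (χ-part p)

  skeleton-connected⇒connected : ∀ {k ℓ} → (∀ p → Recolorable G[ p ]) → k < ℓ → Coloring G k →
                                 RConnected H ℓ → RConnected G ℓ
  skeleton-connected⇒connected {ℓ = ℓ} recolorable k<ℓ κ H-connected =
    connected-through G ℓ (pullback optimalShape coloring) to-reference
    where
    reference = referenceColoring k<ℓ κ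
    open SpareColoring reference
    to-reference : ∀ α → Walk G ℓ α (pullback optimalShape coloring)
    to-reference α with normalize recolorable α
    ... | α₁ , α→α₁ , factored with factored⇒pullback α₁ factored
    ...   | γ , s , α₁≈ =
      α→α₁ ◅◅ ≈⇒walk G ℓ {α₁} {pullback s γ} α₁≈ ◅◅ pullback-walk s (H-connected γ coloring) ◅◅
      fiber-walk (λ p → recolorable p (c p) (χ-part p) (suc (c p)) ℕ.≤-refl) reference s optimalShape

  Witnessed : ∀ {ℓ} → (Fin n → Fin ℓ) → (V H → Fin ℓ) → V H → Set
  Witnessed β δ y = ∃ λ v → part v ≡ proj₁ y × β v ≡ δ y

  witnessed? : ∀ {ℓ} β δ y → Dec (Witnessed {ℓ} β δ y)
  witnessed? β δ y = any? λ v → (part v ≟ᶠ proj₁ y) ×-dec (β v ≟ᶠ δ y)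

  repair : ∀ {ℓ} (β : Coloring G ℓ) (δ : Coloring H ℓ) x₀ →
           (∀ y → y ≢ x₀ → Witnessed (proj₁ β) (proj₁ δ) y) →
           ∃ λ δ′ → Walk H ℓ δ δ′ × (∀ y → Witnessed (proj₁ β) (proj₁ δ′) y)
  repair β δ x₀ others with witnessed? (proj₁ β) (proj₁ δ) x₀
  ... | yes x₀-witnessed = δ , ε , all
    where
    all : ∀ y → Witnessed (proj₁ β) (proj₁ δ) y
    all y with y ≟H x₀
    ... | yes refl = x₀-witnessed
    ... | no y≢x₀  = others y y≢x₀
  ... | no x₀-lost = δ′ , recolor-walk δ x₀ x free , witnessed′
    where
    q = proj₁ x₀
    fresh = missed-value-in (λ i → proj₁ δ (q , i)) (Used (proj₁ β) q) (used-bound β q) (proj₂ x₀)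
                          (dec-false (witnessed? (proj₁ β) (proj₁ δ) x₀) x₀-lost)
    x = proj₁ fresh
    x-used = used⁻ (proj₁ β) (proj₁ (proj₂ fresh))
    free : ∀ y → E H x₀ y → proj₁ δ y ≢ x
    free (.q , j) (inj₁ (refl , _)) = proj₂ (proj₂ fresh) j
    free (r , j) (inj₂ (q≢r , complete)) e with others (r , j) (q≢r ∘ cong proj₁ ∘ sym) | x-used
    ... | v , v∈r , βv | u , u∈q , βu =
      proj₂ β u v (complete u v (∈part u∈q) (∈part v∈r)) (trans βu (trans (sym e) (sym βv)))
    δ′ = recolor δ x₀ x free
    witnessed′ : ∀ y → Witnessed (proj₁ β) (proj₁ δ′) y
    witnessed′ y = by-cases (y ≟H x₀)
      where
      by-cases : Dec (y ≡ x₀) → Witnessed (proj₁ β) (proj₁ δ′) y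
      by-cases (yes refl) = let u , u∈q , βu = x-used in
        u , u∈q , trans βu (sym (recolor-at δ x₀ x free))
      by-cases (no y≢x₀)  = let v , v∈ , βv = others y y≢x₀ in
        v , v∈ , trans βv (sym (recolor-elsewhere δ x₀ x free y≢x₀))

  witness-survives : ∀ {ℓ} {β β′ : Coloring G ℓ} (δ : Coloring H ℓ) w →
                     (∀ v → v ≢ w → proj₁ β v ≡ proj₁ β′ v) →
                     ∀ y → Witnessed (proj₁ β) (proj₁ δ) y →
                     Witnessed (proj₁ β′) (proj₁ δ) y ⊎ (proj₁ y ≡ part w × proj₁ δ y ≡ proj₁ β w)
  witness-survives δ w same y (v , v∈ , βv) with v ≟ᶠ w
  ... | no v≢w   = inj₁ (v , v∈ , trans (sym (same v v≢w)) βv)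
  ... | yes refl = inj₂ (sym v∈ , sym βv)

  track-step : ∀ {ℓ} {β β′ : Coloring G ℓ} (δ : Coloring H ℓ) → Step G ℓ β β′ →
               (∀ y → Witnessed (proj₁ β) (proj₁ δ) y) →
               ∃ λ δ′ → Walk H ℓ δ δ′ × (∀ y → Witnessed (proj₁ β′) (proj₁ δ′) y)
  track-step δ (inj₂ same) witnessed = δ , ε , λ y →
    let v , v∈ , βv = witnessed y in v , v∈ , trans (sym (same v)) βv
  track-step {β = β} {β′} δ (inj₁ (w , _ , same)) witnessed
    with any? (λ i → proj₁ δ (part w , i) ≟ᶠ proj₁ β w)
  ... | yes (i₀ , δ[i₀]≡) = repair β′ δ (part w , i₀) λ y y≢x₀ →
    [ id , (λ (y∈ , δy≡) → contradiction (on-clique y y∈ (trans δy≡ (sym δ[i₀]≡))) y≢x₀) ]′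
      (witness-survives {β = β} {β′} δ w same y (witnessed y))
    where
    on-clique : ∀ y → proj₁ y ≡ part w → proj₁ δ y ≡ proj₁ δ (part w , i₀) → y ≡ (part w , i₀)
    on-clique (p , i) refl e = cong (p ,_) (clique-injective δ e)
  ... | no none = δ , ε , λ y →
    [ id , (λ (y∈ , δy≡) → contradiction (lost y y∈ δy≡) none) ]′
      (witness-survives {β = β} {β′} δ w same y (witnessed y))
    where
    lost : ∀ y → proj₁ y ≡ part w → proj₁ δ y ≡ proj₁ β w → ∃ λ i → proj₁ δ (part w , i) ≡ proj₁ β w
    lost (p , i) refl e = i , e

  track : ∀ {ℓ} {β β′ : Coloring G ℓ} (δ : Coloring H ℓ) → Walk G ℓ β β′ →
          (∀ y → Witnessed (proj₁ β) (proj₁ δ) y) →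
          ∃ λ δ′ → Walk H ℓ δ δ′ × (∀ y → Witnessed (proj₁ β′) (proj₁ δ′) y)
  track δ ε witnessed = δ , ε , witnessed
  track {β = β} δ (_◅_ {j = β₁} st sts) witnessed with track-step {β = β} {β₁} δ st witnessed
  ... | δ₁ , δ→δ₁ , witnessed₁ with track δ₁ sts witnessed₁
  ...   | δ₂ , δ₁→δ₂ , witnessed₂ = δ₂ , δ→δ₁ ◅◅ δ₁→δ₂ , witnessed₂

  cliqueEmbedding : ∀ p → InducedEmbedding (CompleteGraph (c p)) H
  cliqueEmbedding p = record
    { ι           = p ,_
    ; ι-injective = ,-injectiveʳ-UIP (Decidable⇒UIP.≡-irrelevant _≟ᶠ_)
    ; locate      = λ (q , i) → locate q i (q ≟ᶠ p)
    ; reflect     = reflect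
    }
    where
    locate : ∀ q i → Dec (q ≡ p) →
             (∃ λ j → _≡_ {A = V H} (p , j) (q , i)) ⊎ (∀ j → _≢_ {A = V H} (p , j) (q , i))
    locate q i (yes refl) = inj₁ (i , refl)
    locate q i (no q≢p)   = inj₂ λ _ e → q≢p (sym (cong proj₁ e))
    reflect : ∀ {i j} → E H (p , i) (p , j) → i ≢ j
    reflect (inj₁ (_ , ne))  = ne ∘ cong toℕ
    reflect (inj₂ (p≢p , _)) = contradiction refl p≢p

  permute-cliques : ∀ {ℓ} (sc : SpareColoring ℓ) (δ : Coloring H ℓ) →
                    (∀ p i → ∃ λ j → proj₁ δ (p , i) ≡ proj₁ (SpareColoring.coloring sc) (p , j)) →
                    Walk H ℓ δ (SpareColoring.coloring sc)
  permute-cliques sc δ δ-in = walk-by-blocks λ p →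
    walk-within-block p (cliqueEmbedding p) (λ _ → refl) (λ { (q , i) refl → i , refl })
      (palette p) (palette-injective p) (avoids p) (lifted p) (standard p)
      (λ i → sym (proj₂ (δ-in p i))) (λ _ → refl)
      (complete-recolorable (c p) (lifted p) (standard p))
    where
    open SpareColoring sc
    compatible : ∀ y z → E H y z → proj₁ y ≢ proj₁ z → proj₁ δ y ≢ proj₁ coloring z
    compatible (p , i) (q , j) yz p≢q e =
      proj₂ coloring _ (q , j) (inj₂ (p≢q , cross-complete yz p≢q)) (trans (sym (proj₂ (δ-in p i))) e)
    open BlockWalk H-sym proj₁ δ coloring compatible

    lifted : ∀ p → Coloring (CompleteGraph (c p)) (suc (c p))
    lifted p = (λ i → suc (proj₁ (δ-in p i))) , λ i j i≢j e → i≢j (clique-injective δ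
      (trans (proj₂ (δ-in p i))
        (trans (cong (λ k → proj₁ coloring (p , k)) (suc-injective e)) (sym (proj₂ (δ-in p j))))))

    standard : ∀ p → Coloring (CompleteGraph (c p)) (suc (c p))
    standard p = suc , λ i j i≢j → i≢j ∘ suc-injective

    avoids : ∀ p y j → (∀ j′ → (p , j′) ≢ y) → E H y (p , j) → ∀ x → interpolate (toℕ p) y ≢ palette p x
    avoids p (q , i) j out yp x e =
      let i′ , stage≡ = stage-in-reference in
      palette-fresh i′ q≢p (cross-complete yp q≢p) x (trans (sym stage≡) e)
      where
      q≢p : q ≢ p
      q≢p refl = out i refl
      stage-in-reference : ∃ λ i′ → interpolate (toℕ p) (q , i) ≡ proj₁ coloring (q , i′)
      stage-in-reference =
        [ (λ e → _ , trans e (proj₂ (δ-in q i))) , i ,_ ]′ (interpolate-either (toℕ p) (q , i))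

  pullback-witnessed : ∀ {ℓ} (γ : Coloring H ℓ) y → Witnessed (proj₁ (pullback optimalShape γ)) (proj₁ γ) y
  pullback-witnessed γ (p , i) with optimal-surjective (optimalShape p) (proj₂ (χ-part p)) i
  ... | (v , v∈p) , refl = v , ∈part⁻ v∈p , cong (proj₁ γ) (π-in optimalShape (v , v∈p))

  witnessed-in-pullback : ∀ {ℓ} s (γ δ : V H → Fin ℓ) y → Witnessed (γ ∘ π s) δ y →
                          ∃ λ j → δ y ≡ γ (proj₁ y , j)
  witnessed-in-pullback s γ δ y (v , v∈ , e) with in-clique v∈ (proj₂ (π s v))
  ... | j , π≡ = j , trans (sym e) (cong γ π≡)

  connected⇒skeleton-connected : ∀ {k ℓ} → k < ℓ → Coloring G k → RConnected G ℓ → RConnected H ℓ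
  connected⇒skeleton-connected {ℓ = ℓ} k<ℓ κ G-connected = connected-through H ℓ coloring to-reference
    where
    reference = referenceColoring k<ℓ κ
    open SpareColoring reference
    to-reference : ∀ γ → Walk H ℓ γ coloring
    to-reference γ
      with track γ (G-connected (pullback optimalShape γ) (pullback optimalShape coloring))
                   (pullback-witnessed γ)
    ... | δ , γ→δ , witnessed = γ→δ ◅◅ permute-cliques reference δ λ p i →
      witnessed-in-pullback optimalShape (proj₁ coloring) (proj₁ δ) (p , i) (witnessed (p , i))

theorem10 : (n : ℕ) (adj : Fin n → Fin n → Bool) →
    (∀ u v → adj u v ≡ adj v u) → (∀ v → adj v v ≡ false) →
    (m : ℕ) (part : Fin n → Fin m) →
    IsMaximalModulePartition n adj m part →
    (c : Fin m → ℕ) →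
    (∀ p → IsChromaticNumber (Induced (FinGraph n adj) (Part part p)) (c p)) →
    (ℓ : ℕ) → (∀ k → IsChromaticNumber (FinGraph n adj) k → suc k ≤ ℓ) →
    (∀ (S : Fin n → Bool) → (∃ λ v → S v ≡ false) →
       Recolorable (Induced (FinGraph n adj) S)) →
    (RConnected (FinGraph n adj) ℓ → RConnected (CliqueSkeleton n adj m part c) ℓ)
    × (RConnected (CliqueSkeleton n adj m part c) ℓ → RConnected (FinGraph n adj) ℓ)
theorem10 n adj adj-sym irreflexive m part (_ , maximal) c χ-part ℓ ℓ>χ proper-recolorable =
  connected⇒skeleton-connected k<ℓ κ , skeleton-connected⇒connected recolorable k<ℓ κ
  where
  open Skeleton n adj adj-sym m part (proj₁ ∘ maximal) c χ-part
  χ = chromaticNumber n adj irreflexive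
  κ = proj₁ (proj₂ χ)
  k<ℓ = ℓ>χ (proj₁ χ) (proj₂ χ)
  recolorable : ∀ p → Recolorable G[ p ]
  recolorable p = proper-recolorable (Part part p) (proj₁ (proj₂ (maximal p)))
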